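{- Let $Q=(q_n)_{n\ge1}$ be a basic sequence that is infinite in limit, and let $F$ be a $Q$-special sequence. Then $x_F$ is not simply $Q$-normal.
   Context: A basic sequence is a sequence $Q=(q_n)_{n\ge1}$ of integers with $q_n\ge 2$; it is infinite in limit if $q_n\to\infty$. For $x\in[0,1)$ the $Q$-Cantor series expansion of $x$ is the unique expansion $x=\sum_{n\ge1}\frac{E_n}{q_1q_2\cdots q_n}$ with integers $E_n\in\{0,\dots,q_n-1\}$ and $E_n\neq q_n-1$ for infinitely many $n$. Let $Q_n^{(1)}=\sum_{j=1}^n \frac1{q_j}$ and, for an integer $d\ge0$, let $N_n^Q(d,x)=\#\{j\le n: E_j=d\}$. The number $x$ is simply $Q$-normal if $\lim_{n\to\infty} N_n^Q(d,x)/Q_n^{(1)}=1$ for every integer $d\ge 0$. Construction (for $Q$ infinite in limit): for each positive integer $j$ let $\nu_j=\min\{N: q_m\ge 2j^2 \text{ for all } m\ge N\}$. Let $l_1=\max(\nu_2-1,1)$ and, recursively for $i\ge2$, let $l_i$ be the smallest positive integer $k$ with $l_1+2l_2+\cdots+(i-1)l_{i-1}+ik\ge \nu_{i+1}-1$. Put $L_0=0$, $L_i=\sum_{j=1}^i jl_j$. Let $\mathbb N=\{1,2,\dots\}$, $S_Q=\{(a,b,c)\in\mathbb N^3: b\le l_a,\ c\le a\}$ and $\phi_Q(a,b,c)=L_{a-1}+(b-1)a+c$ (a bijection $S_Q\to\mathbb N$). A $Q$-special sequence is a family of integers $F=(F_{(a,b,c)})_{(a,b,c)\in S_Q}$ with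 $F_{(a,b,1)}=0$ for all $(a,b,1)\in S_Q$, and $\frac{F_{(a,b,c)}}{q_{\phi_Q(a,b,c)}}\in\left[\frac{c-1}{a}-\frac{1}{2a^2},\frac{c-1}{a}+\frac{1}{2a^2}\right]$ for $(a,b,c)\in S_Q$ with $c>1$. For such $F$ put $E_{F,n}=F_{\phi_Q^{ -1}(n)}$ and $x_F=\sum_{n\ge1}\frac{E_{F,n}}{q_1\cdots q_n}$. -}

module Defs where

open import Data.Nat as ℕ using (ℕ; zero; suc; _+_; _*_; _∸_; _⊔_)
open import Data.Integer as ℤ using (ℤ)
open import Data.Rational as ℚ using (ℚ; 0ℚ; 1ℚ)
open import Data.Rational.Properties using () renaming (_≟_ to _≟ℚ_)
open import Data.Product using (Σ; _×_; ∃-syntax)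
open import Relation.Nullary using (¬_; yes; no)
open import Relation.Binary.PropositionalEquality using (_≡_; _≢_)

-- Indexing convention: all sequences are 1-based as in the paper;
-- a function s : ℕ → _ represents (s_n)_{n≥1}, the value s 0 is ignored.

-- 1/n as a rational (with the harmless convention 1/0 = 0; only used for n ≥ 1).
recipℕ : ℕ → ℚ
recipℕ zero    = 0ℚ
recipℕ (suc n) = ℤ.+ 1 ℚ./ suc n

-- p / r in ℚ (convention p/0 = 0; only used with r ≠ 0).
divℚ : ℚ → ℚ → ℚ
divℚ p r with r ≟ℚ 0ℚ
... | yes _  = 0ℚ
... | no r≢0 = p ℚ.* (ℚ.1/_ r {{ℚ.≢-nonZero r≢0}})

sumℚ : (ℕ → ℚ) → ℕ → ℚ
sumℚ f zero    = 0ℚ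
sumℚ f (suc n) = sumℚ f n ℚ.+ f (suc n)

sumℕ : (ℕ → ℕ) → ℕ → ℕ
sumℕ f zero    = 0
sumℕ f (suc n) = sumℕ f n + f (suc n)

prodQ : (ℕ → ℕ) → ℕ → ℕ
prodQ q zero    = 1
prodQ q (suc n) = prodQ q n * q (suc n)

IsBasic : (ℕ → ℕ) → Set
IsBasic q = ∀ n → 1 ℕ.≤ n → 2 ℕ.≤ q n

InfiniteInLimit : (ℕ → ℕ) → Set
InfiniteInLimit q = ∀ M → ∃[ N ] (∀ n → N ℕ.≤ n → M ℕ.≤ q n)

Q1 : (ℕ → ℕ) → ℕ → ℚ
Q1 q n = sumℚ (λ j → recipℕ (q j)) n

-- N_n^Q(d,x) computed from the digit sequence D of x
countDigit : (ℕ → ℕ) → ℕ → ℕ → ℕ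
countDigit D d n = sumℕ (λ j → ind j) n
  where
  ind : ℕ → ℕ
  ind j with D j ℕ.≟ d
  ... | yes _ = 1
  ... | no _  = 0

ConvergesTo : (ℕ → ℚ) → ℚ → Set
ConvergesTo s L = ∀ (ε : ℚ) → 0ℚ ℚ.< ε →
  ∃[ N ] (∀ n → N ℕ.≤ n → 1 ℕ.≤ n → ℚ.∣ s n ℚ.- L ∣ ℚ.< ε)

-- D is the Q-Cantor series expansion digit sequence of some x ∈ [0,1):
-- 0 ≤ E_n ≤ q_n - 1 and E_n ≠ q_n - 1 for infinitely many n.
IsCantorDigits : (ℕ → ℕ) → (ℕ → ℕ) → Set
IsCantorDigits q D =
  (∀ n → 1 ℕ.≤ n → D n ℕ.< q n) ×
  (∀ M → ∃[ n ] (M ℕ.≤ n × 1 ℕ.≤ n × D n ≢ q n ∸ 1))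

partialSum : (ℕ → ℕ) → (ℕ → ℤ) → ℕ → ℚ
partialSum q E n = sumℚ (λ k → ((E k) ℚ./ 1) ℚ.* recipℕ (prodQ q k)) n

-- The Q-Cantor series with digits D and with digits E have the same sum
-- (the difference of partial sums tends to 0).
SameValue : (ℕ → ℕ) → (ℕ → ℕ) → (ℕ → ℤ) → Set
SameValue q D E =
  ConvergesTo (λ n → partialSum q (λ k → ℤ.+ (D k)) n ℚ.- partialSum q E n) 0ℚ

SimplyNormal : (ℕ → ℕ) → (ℕ → ℕ) → Set
SimplyNormal q D = ∀ (d : ℕ) →
  ConvergesTo (λ n → divℚ (((ℤ.+ (countDigit D d n)) ℚ./ 1)) (Q1 q n)) 1ℚ

IsNu : (ℕ → ℕ) → (ℕ → ℕ) → Set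
IsNu q ν = ∀ j → 1 ℕ.≤ j →
  (1 ℕ.≤ ν j) ×
  (∀ m → ν j ℕ.≤ m → 2 * (j * j) ℕ.≤ q m) ×
  (∀ N → 1 ℕ.≤ N → N ℕ.< ν j → ¬ (∀ m → N ℕ.≤ m → 2 * (j * j) ℕ.≤ q m))

Lsum : (ℕ → ℕ) → ℕ → ℕ
Lsum l i = sumℕ (λ j → j * l j) i

IsL : (ℕ → ℕ) → (ℕ → ℕ) → Set
IsL ν l =
  (l 1 ≡ (ν 2 ∸ 1) ⊔ 1) ×
  (∀ i → 2 ℕ.≤ i →
     (1 ℕ.≤ l i) ×
     (ν (suc i) ∸ 1 ℕ.≤ Lsum l (i ∸ 1) + i * l i) ×
     (∀ k → 1 ℕ.≤ k → k ℕ.< l i → ¬ (ν (suc i) ∸ 1 ℕ.≤ Lsum l (i ∸ 1) + i * k)))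

InS : (ℕ → ℕ) → ℕ → ℕ → ℕ → Set
InS l a b c = (1 ℕ.≤ a) × (1 ℕ.≤ b) × (b ℕ.≤ l a) × (1 ℕ.≤ c) × (c ℕ.≤ a)

φ : (ℕ → ℕ) → ℕ → ℕ → ℕ → ℕ
φ l a b c = Lsum l (a ∸ 1) + (b ∸ 1) * a + c

-- Q-special sequence F : S_Q → ℤ (values outside S_Q are irrelevant)
IsSpecial : (ℕ → ℕ) → (ℕ → ℕ) → (ℕ → ℕ → ℕ → ℤ) → Set
IsSpecial q l F =
  (∀ a b → InS l a b 1 → F a b 1 ≡ ℤ.+ 0) ×
  (∀ a b c → InS l a b c → 2 ℕ.≤ c →
     let r   = ((F a b c) ℚ./ 1) ℚ.* recipℕ (q (φ l a b c))
         mid = ((ℤ.+ (c ∸ 1)) ℚ./ 1) ℚ.* recipℕ a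
         rad = recipℕ (2 * (a * a))
     in (mid ℚ.- rad ℚ.≤ r) × (r ℚ.≤ mid ℚ.+ rad))

module Submission where

-- Every digit of the special expansion E_F is either 0 (positions
-- with c = 1) or a number F_(a,b,c) ≥ 2: since q_φ(a,b,c) ≥ 2a², the window
-- [(c-1)/a − 1/(2a²), (c-1)/a + 1/(2a²)] for F/q excludes both [0, 1/q] and
-- [1, ∞).  Hence E_F is a proper Q-Cantor digit sequence (digits in [0, q_n),
-- infinitely many zeros) that never takes the value 1.  By uniqueness of
-- Q-Cantor expansions, the digit sequence D of x_F coincides with E_F, so the
-- digit 1 never occurs in D and N_n(1, x_F)/Q_n^(1) = 0 for every n, which
-- cannot tend to 1.  (That Q is infinite in limit is only needed for the
-- sequence ν to exist; here ν is given together with its defining properties.)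

open import Defs
open import Data.Nat as ℕ using (ℕ; zero; suc; _≤_; _<_; s≤s; z≤n; _≤?_)
import Data.Nat.Properties as ℕP
open import Data.Nat.DivMod using (_/_; _%_; m≡m%n+[m/n]*n; m%n<n; m<n*o⇒m/o<n)
open import Data.Integer as ℤ using (ℤ; +_)
import Data.Integer.Properties as ℤP
open import Data.Rational as ℚ using (ℚ; 0ℚ; 1ℚ)
import Data.Rational.Properties as ℚP
import Data.Rational.Unnormalised as U
import Data.Rational.Unnormalised.Properties as UP
open import Data.Product using (_×_; _,_; ∃-syntax; proj₁; proj₂)
open import Data.Sum using (_⊎_; inj₁; inj₂)
open import Data.Empty using (⊥-elim)
open import Function using (_∘_)
open import Relation.Nullary using (¬_; yes; no)
open import Relation.Binary.Definitions using (tri<; tri≈; tri>)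
open import Relation.Binary.PropositionalEquality
open import Data.Integer.Solver using () renaming (module +-*-Solver to ℤSolver)
open import Data.Nat.Solver using () renaming (module +-*-Solver to ℕSolver)
open import Data.Rational.Solver using () renaming (module +-*-Solver to ℚSolver)

ι : ℤ → ℚ
ι z = z ℚ./ 1

ι-toℚᵘ : ∀ z → ℚ.toℚᵘ (ι z) U.≃ U.mkℚᵘ z 0
ι-toℚᵘ z = ℚP.toℚᵘ-fromℚᵘ (U.mkℚᵘ z 0)

ι-+ : ∀ a b → ι (a ℤ.+ b) ≡ ι a ℚ.+ ι b
ι-+ a b = ℚP.toℚᵘ-injective (UP.≃-trans (ι-toℚᵘ (a ℤ.+ b)) (UP.≃-trans fractions
   (UP.≃-sym (UP.≃-trans (ℚP.toℚᵘ-homo-+ (ι a) (ι b)) (UP.+-cong (ι-toℚᵘ a) (ι-toℚᵘ b))))))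
  where
  open ℤSolver
  fractions : U.mkℚᵘ (a ℤ.+ b) 0 U.≃ (U.mkℚᵘ a 0 U.+ U.mkℚᵘ b 0)
  fractions = U.*≡* (solve 2 (λ x y → (x :+ y) :* con (+ 1) := (x :* con (+ 1) :+ y :* con (+ 1)) :* con (+ 1)) refl a b)

ι-* : ∀ a b → ι (a ℤ.* b) ≡ ι a ℚ.* ι b
ι-* a b = ℚP.toℚᵘ-injective (UP.≃-trans (ι-toℚᵘ (a ℤ.* b)) (UP.≃-trans fractions
   (UP.≃-sym (UP.≃-trans (ℚP.toℚᵘ-homo-* (ι a) (ι b)) (UP.*-cong (ι-toℚᵘ a) (ι-toℚᵘ b))))))
  where
  fractions : U.mkℚᵘ (a ℤ.* b) 0 U.≃ (U.mkℚᵘ a 0 U.* U.mkℚᵘ b 0)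
  fractions = U.*≡* refl

ι-mono : ∀ {a b} → a ℤ.≤ b → ι a ℚ.≤ ι b
ι-mono {a} {b} a≤b = ℚP.toℚᵘ-cancel-≤
  (UP.≤-respʳ-≃ (UP.≃-sym (ι-toℚᵘ b)) (UP.≤-respˡ-≃ (UP.≃-sym (ι-toℚᵘ a))
    (U.*≤* (ℤP.*-monoʳ-≤-nonNeg (+ 1) a≤b))))

ι-cancel : ∀ {a b} → ι a ℚ.≤ ι b → a ℤ.≤ b
ι-cancel {a} {b} h
  with UP.≤-respʳ-≃ (ι-toℚᵘ b) (UP.≤-respˡ-≃ (ι-toℚᵘ a) (ℚP.toℚᵘ-mono-≤ h))
... | U.*≤* a·1≤b·1 = subst₂ ℤ._≤_ (ℤP.*-identityʳ a) (ℤP.*-identityʳ b) a·1≤b·1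

ι-nonNeg : ∀ n → ℚ.NonNegative (ι (+ n))
ι-nonNeg n = ℚP.normalize-nonNeg n 1

recip-nonNeg : ∀ n → ℚ.NonNegative (recipℕ n)
recip-nonNeg zero    = _
recip-nonNeg (suc k) = ℚP.normalize-nonNeg 1 (suc k)

recip-pos : ∀ n → 1 ≤ n → 0ℚ ℚ.< recipℕ n
recip-pos (suc k) _ = ℚP.positive⁻¹ _ {{ℚP.normalize-pos 1 (suc k)}}

recip-inverse : ∀ n → 1 ≤ n → recipℕ n ℚ.* ι (+ n) ≡ 1ℚ
recip-inverse (suc k) _ = ℚP.toℚᵘ-injective
  (UP.≃-trans (ℚP.toℚᵘ-homo-* (recipℕ (suc k)) (ι (+ suc k)))
  (UP.≃-trans (UP.*-cong (ℚP.toℚᵘ-fromℚᵘ (U.mkℚᵘ (+ 1) k)) (ι-toℚᵘ (+ suc k)))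
              (U.*≡* (cong (λ t → + suc t)
                (trans (cong (ℕ._* 1) (ℕP.+-identityʳ k)) (sym (ℕP.+-identityʳ (k ℕ.* 1))))))))

recip-* : ∀ x y → 1 ≤ x → 1 ≤ y → recipℕ (x ℕ.* y) ℚ.* ι (+ y) ≡ recipℕ x
recip-* x y x≥1 y≥1 = begin
    R ℚ.* ι (+ y)                                ≡⟨ sym (ℚP.*-identityˡ _) ⟩
    1ℚ ℚ.* (R ℚ.* ι (+ y))                       ≡⟨ cong (ℚ._* (R ℚ.* ι (+ y))) (sym (recip-inverse x x≥1)) ⟩
    (recipℕ x ℚ.* ι (+ x)) ℚ.* (R ℚ.* ι (+ y))  ≡⟨ solve 4 (λ a b c d → (a :* b) :* (c :* d) := a :* (c :* (b :* d))) refl (recipℕ x) (ι (+ x)) R (ι (+ y)) ⟩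
    recipℕ x ℚ.* (R ℚ.* (ι (+ x) ℚ.* ι (+ y)))  ≡⟨ cong (λ z → recipℕ x ℚ.* (R ℚ.* z)) (sym (trans (cong ι (ℤP.pos-* x y)) (ι-* (+ x) (+ y)))) ⟩
    recipℕ x ℚ.* (R ℚ.* ι (+ (x ℕ.* y)))        ≡⟨ cong (recipℕ x ℚ.*_) (recip-inverse (x ℕ.* y) (ℕP.*-mono-≤ x≥1 y≥1)) ⟩
    recipℕ x ℚ.* 1ℚ                              ≡⟨ ℚP.*-identityʳ _ ⟩
    recipℕ x ∎
  where
  open ≡-Reasoning
  open ℚSolver
  R = recipℕ (x ℕ.* y)

*ι-mono : ∀ {X Y} n → X ℚ.≤ Y → X ℚ.* ι (+ n) ℚ.≤ Y ℚ.* ι (+ n)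
*ι-mono n = ℚP.*-monoʳ-≤-nonNeg (ι (+ n)) {{ι-nonNeg n}}

*recip-mono : ∀ {X Y} n → X ℚ.≤ Y → X ℚ.* recipℕ n ℚ.≤ Y ℚ.* recipℕ n
*recip-mono n = ℚP.*-monoʳ-≤-nonNeg (recipℕ n) {{recip-nonNeg n}}

recip-antitone : ∀ x y → 1 ≤ x → x ≤ y → recipℕ y ℚ.≤ recipℕ x
recip-antitone x y x≥1 x≤y = begin
    recipℕ y                                  ≡⟨ sym (ℚP.*-identityʳ _) ⟩
    recipℕ y ℚ.* 1ℚ                           ≡⟨ cong (recipℕ y ℚ.*_) (sym (recip-inverse x x≥1)) ⟩
    recipℕ y ℚ.* (recipℕ x ℚ.* ι (+ x))      ≡⟨ swap-factors (recipℕ y) (recipℕ x) (ι (+ x)) ⟩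
    (recipℕ y ℚ.* ι (+ x)) ℚ.* recipℕ x      ≤⟨ *recip-mono x (ℚP.*-monoˡ-≤-nonNeg (recipℕ y) {{recip-nonNeg y}} (ι-mono (ℤ.+≤+ x≤y))) ⟩
    (recipℕ y ℚ.* ι (+ y)) ℚ.* recipℕ x      ≡⟨ cong (ℚ._* recipℕ x) (recip-inverse y (ℕP.≤-trans x≥1 x≤y)) ⟩
    1ℚ ℚ.* recipℕ x                           ≡⟨ ℚP.*-identityˡ _ ⟩
    recipℕ x ∎
  where
  open ℚP.≤-Reasoning
  swap-factors : ∀ a b c → a ℚ.* (b ℚ.* c) ≡ (a ℚ.* c) ℚ.* b
  swap-factors = solve 3 (λ a b c → a :* (b :* c) := (a :* c) :* b) refl
    where open ℚSolver

≤⇒0≤- : ∀ {u v} → u ℚ.≤ v → 0ℚ ℚ.≤ v ℚ.- u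
≤⇒0≤- {u} {v} u≤v = subst (ℚ._≤ v ℚ.- u) (ℚP.+-inverseʳ u) (ℚP.+-monoˡ-≤ (ℚ.- u) u≤v)

0≤-⇒≤ : ∀ {u v} → 0ℚ ℚ.≤ v ℚ.- u → u ℚ.≤ v
0≤-⇒≤ {u} {v} 0≤v-u = subst₂ ℚ._≤_ (ℚP.+-identityˡ u) v-u+u≡v (ℚP.+-monoˡ-≤ u 0≤v-u)
  where
  open ℚSolver
  v-u+u≡v : (v ℚ.- u) ℚ.+ u ≡ v
  v-u+u≡v = solve 2 (λ u v → (v :- u) :+ u := v) refl u v

≤-from-gaps : ∀ u v u₁ v₁ u₂ v₂ → u₁ ℚ.≤ v₁ → u₂ ℚ.≤ v₂ →
              v ℚ.- u ≡ (v₁ ℚ.- u₁) ℚ.+ (v₂ ℚ.- u₂) → u ℚ.≤ v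
≤-from-gaps u v u₁ v₁ u₂ v₂ h₁ h₂ e =
  0≤-⇒≤ (subst (0ℚ ℚ.≤_) (sym e) (ℚP.+-mono-≤ (≤⇒0≤- h₁) (≤⇒0≤- h₂)))

cantor-step : ∀ c d a b t s P Q → 1 ≤ P → 1 ≤ Q →
  c ℚ.+ ι s ℚ.* recipℕ P ℚ.≤ d → t ℤ.+ b ℤ.≤ a ℤ.+ s ℤ.* + Q →
  c ℚ.+ ι t ℚ.* recipℕ (P ℕ.* Q) ℚ.≤ (d ℚ.+ ι a ℚ.* recipℕ (P ℕ.* Q)) ℚ.- ι b ℚ.* recipℕ (P ℕ.* Q)
cantor-step c d a b t s P Q P≥1 Q≥1 old new =
  ≤-from-gaps _ _ (c ℚ.+ ι s ℚ.* (r ℚ.* ι (+ Q))) d ((ι t ℚ.+ ι b) ℚ.* r) ((ι a ℚ.+ ι s ℚ.* ι (+ Q)) ℚ.* r)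
    (subst (λ z → c ℚ.+ ι s ℚ.* z ℚ.≤ d) (sym (recip-* P Q P≥1 Q≥1)) old)
    new-scaled
    (solve 8 (λ c d a b t s Q r →
        ((d :+ a :* r) :- b :* r) :- (c :+ t :* r)
        := (d :- (c :+ s :* (r :* Q))) :+ ((a :+ s :* Q) :* r :- (t :+ b) :* r))
      refl c d (ι a) (ι b) (ι t) (ι s) (ι (+ Q)) r)
  where
  open ℚSolver
  r = recipℕ (P ℕ.* Q)
  new-scaled : (ι t ℚ.+ ι b) ℚ.* r ℚ.≤ (ι a ℚ.+ ι s ℚ.* ι (+ Q)) ℚ.* r
  new-scaled = subst₂ (λ x y → x ℚ.* r ℚ.≤ y ℚ.* r)
    (ι-+ t b) (trans (ι-+ a _) (cong (ι a ℚ.+_) (ι-* s (+ Q))))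
    (*recip-mono (P ℕ.* Q) (ι-mono new))

-- A, B are integer digit sequences with B_i − A_i ≤ q_i − 1 at every position,
-- so a single digit can lower S_A − S_B by at most (q_i − 1)/(q_1⋯q_i).
module TailEstimate (q : ℕ → ℕ) (q≥1 : ∀ i → 1 ≤ i → 1 ≤ q i) (A B : ℕ → ℤ)
  (gap : ∀ i → 1 ≤ i → + 1 ℤ.+ B i ℤ.≤ A i ℤ.+ + 1 ℤ.* + q i) where

  P : ℕ → ℕ
  P = prodQ q

  P≥1 : ∀ n → 1 ≤ P n
  P≥1 zero    = s≤s z≤n
  P≥1 (suc n) = ℕP.*-mono-≤ (P≥1 n) (q≥1 (suc n) (s≤s z≤n))

  diff : ℕ → ℚ
  diff n = partialSum q A n ℚ.- partialSum q B n

  diff-suc : ∀ n → diff (suc n) ≡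
    (diff n ℚ.+ ι (A (suc n)) ℚ.* recipℕ (P (suc n))) ℚ.- ι (B (suc n)) ℚ.* recipℕ (P (suc n))
  diff-suc n = solve 4 (λ x y a b → (x :+ a) :- (y :+ b) := ((x :- y) :+ a) :- b) refl
    (partialSum q A n) (partialSum q B n)
    (ι (A (suc n)) ℚ.* recipℕ (P (suc n))) (ι (B (suc n)) ℚ.* recipℕ (P (suc n)))
    where open ℚSolver

  diff-agree : ∀ n → (∀ j → 1 ≤ j → j ≤ n → A j ≡ B j) → diff n ≡ 0ℚ
  diff-agree zero    _     = refl
  diff-agree (suc n) agree = begin
    diff (suc n)                                               ≡⟨ diff-suc n ⟩
    (diff n ℚ.+ ι (A (suc n)) ℚ.* R) ℚ.- ι (B (suc n)) ℚ.* R
      ≡⟨ cong (λ z → (diff n ℚ.+ ι z ℚ.* R) ℚ.- ι (B (suc n)) ℚ.* R) (agree (suc n) (s≤s z≤n) ℕP.≤-refl) ⟩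
    (diff n ℚ.+ ι (B (suc n)) ℚ.* R) ℚ.- ι (B (suc n)) ℚ.* R
      ≡⟨ add-sub (diff n) (ι (B (suc n)) ℚ.* R) ⟩
    diff n                                                     ≡⟨ diff-agree n (λ j j≥1 j≤n → agree j j≥1 (ℕP.m≤n⇒m≤1+n j≤n)) ⟩
    0ℚ ∎
    where
    open ≡-Reasoning
    R = recipℕ (P (suc n))
    add-sub : ∀ x y → (x ℚ.+ y) ℚ.- y ≡ x
    add-sub = solve 2 (λ x y → (x :+ y) :- y := x) refl
      where open ℚSolver

  diff-step : ∀ c t s n → c ℚ.+ ι s ℚ.* recipℕ (P n) ℚ.≤ diff n →
    t ℤ.+ B (suc n) ℤ.≤ A (suc n) ℤ.+ s ℤ.* + q (suc n) →
    c ℚ.+ ι t ℚ.* recipℕ (P (suc n)) ℚ.≤ diff (suc n)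
  diff-step c t s n old new = subst (c ℚ.+ ι t ℚ.* recipℕ (P (suc n)) ℚ.≤_) (sym (diff-suc n))
    (cantor-step c (diff n) (A (suc n)) (B (suc n)) t s (P n) (q (suc n))
      (P≥1 n) (q≥1 (suc n) (s≤s z≤n)) old new)

  Exceeds : ℚ → ℕ → Set
  Exceeds c n = c ℚ.+ ι (+ 1) ℚ.* recipℕ (P n) ℚ.≤ diff n

  exceeds-persists : ∀ c n j → Exceeds c n → Exceeds c (j ℕ.+ n)
  exceeds-persists c n zero    h = h
  exceeds-persists c n (suc j) h =
    diff-step c (+ 1) (+ 1) (j ℕ.+ n) (exceeds-persists c n j h) (gap (suc (j ℕ.+ n)) (s≤s z≤n))

  exceeds-from : ∀ c {m n} → m ≤ n → Exceeds c m → Exceeds c n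
  exceeds-from c {m} {n} m≤n h = subst (Exceeds c) (ℕP.m∸n+n≡m m≤n) (exceeds-persists c m (n ℕ.∸ m) h)

  exceeds⇒≤ : ∀ c n → Exceeds c n → c ℚ.≤ diff n
  exceeds⇒≤ c n = ℚP.≤-trans c≤c+1/P
    where
    c≤c+1/P : c ℚ.≤ c ℚ.+ ι (+ 1) ℚ.* recipℕ (P n)
    c≤c+1/P = subst₂ ℚ._≤_ (ℚP.+-identityʳ c) (cong (c ℚ.+_) (sym (ℚP.*-identityˡ (recipℕ (P n)))))
      (ℚP.+-monoʳ-≤ c (ℚP.nonNegative⁻¹ (recipℕ (P n)) {{recip-nonNeg (P n)}}))

  separated : ∀ k → (∀ j → 1 ≤ j → j ≤ k → A j ≡ B j) → B (suc k) ℤ.< A (suc k) →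
    ∀ m → suc k ≤ m → + 2 ℤ.+ B (suc m) ℤ.≤ A (suc m) ℤ.+ + 1 ℤ.* + q (suc m) →
    ∀ n → suc m ≤ n → recipℕ (P (suc m)) ℚ.≤ diff n
  separated k agree B<A m k<m slack n m<n = exceeds⇒≤ R n (exceeds-from R m<n at-m+1)
    where
    R = recipℕ (P (suc m))
    start : 0ℚ ℚ.+ ι (+ 0) ℚ.* recipℕ (P k) ℚ.≤ diff k
    start = ℚP.≤-reflexive (trans (ℚP.+-identityˡ _) (trans (ℚP.*-zeroˡ (recipℕ (P k))) (sym (diff-agree k agree))))
    first : + 1 ℤ.+ B (suc k) ℤ.≤ A (suc k) ℤ.+ + 0 ℤ.* + q (suc k)
    first = subst (+ 1 ℤ.+ B (suc k) ℤ.≤_)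
      (sym (trans (cong (λ z → A (suc k) ℤ.+ z) (ℤP.*-zeroˡ (+ q (suc k)))) (ℤP.+-identityʳ _)))
      (ℤP.i<j⇒suc[i]≤j B<A)
    at-m : Exceeds 0ℚ m
    at-m = exceeds-from 0ℚ k<m (diff-step 0ℚ (+ 1) (+ 0) k start first)
    at-m+1 : Exceeds R (suc m)
    at-m+1 = subst (ℚ._≤ diff (suc m)) two-units (diff-step 0ℚ (+ 2) (+ 1) m at-m slack)
      where
      open ℚSolver
      two-units : 0ℚ ℚ.+ ι (+ 2) ℚ.* R ≡ R ℚ.+ ι (+ 1) ℚ.* R
      two-units = solve 1 (λ R → con 0ℚ :+ (con 1ℚ :+ con 1ℚ) :* R := R :+ con 1ℚ :* R) refl R

ProperDigits : (ℕ → ℕ) → (ℕ → ℤ) → Set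
ProperDigits q A =
  (∀ i → 1 ≤ i → (+ 0 ℤ.≤ A i) × (A i ℤ.+ + 1 ℤ.≤ + q i)) ×
  (∀ M → ∃[ n ] (M ≤ n × 1 ≤ n × A n ℤ.+ + 2 ℤ.≤ + q n))

bounded-below⇒¬→0 : ∀ s ε M → 0ℚ ℚ.< ε → (∀ n → M ≤ n → ε ℚ.≤ s n) → ¬ ConvergesTo s 0ℚ
bounded-below⇒¬→0 s ε M ε>0 above conv with conv ε ε>0
... | N , close = ℚP.<-irrefl refl (ℚP.<-≤-trans (close n N≤n (ℕP.≤-trans (s≤s z≤n) M<n)) ε≤∣sn∣)
  where
  n = N ℕ.+ suc M
  N≤n : N ≤ n
  N≤n = ℕP.m≤m+n N (suc M)
  M<n : suc M ≤ n
  M<n = ℕP.m≤n+m (suc M) N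
  ε≤sn : ε ℚ.≤ s n
  ε≤sn = above n (ℕP.≤-trans (ℕP.n≤1+n M) M<n)
  ε≤∣sn∣ : ε ℚ.≤ ℚ.∣ s n ℚ.- 0ℚ ∣
  ε≤∣sn∣ = subst (ε ℚ.≤_)
    (sym (trans (cong ℚ.∣_∣ (ℚP.+-identityʳ (s n))) (ℚP.0≤p⇒∣p∣≡p (ℚP.≤-trans (ℚP.<⇒≤ ε>0) ε≤sn))))
    ε≤sn

converges0-swap : ∀ (x y : ℕ → ℚ) → ConvergesTo (λ n → x n ℚ.- y n) 0ℚ → ConvergesTo (λ n → y n ℚ.- x n) 0ℚ
converges0-swap x y conv ε ε>0 with conv ε ε>0
... | N , close = N , λ n N≤n n≥1 → subst (ℚ._< ε) (distance-sym (x n) (y n)) (close n N≤n n≥1)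
  where
  distance-sym : ∀ a b → ℚ.∣ (a ℚ.- b) ℚ.- 0ℚ ∣ ≡ ℚ.∣ (b ℚ.- a) ℚ.- 0ℚ ∣
  distance-sym a b = trans (sym (ℚP.∣-p∣≡∣p∣ _))
    (cong ℚ.∣_∣ (solve 2 (λ a b → :- ((a :- b) :- con 0ℚ) := (b :- a) :- con 0ℚ) refl a b))
    where open ℚSolver

module Uniqueness (q : ℕ → ℕ) (q≥2 : ∀ i → 1 ≤ i → 2 ≤ q i) where

  q≥1 : ∀ i → 1 ≤ i → 1 ≤ q i
  q≥1 i i≥1 = ℕP.≤-trans (s≤s z≤n) (q≥2 i i≥1)

  q≤digit+q : ∀ i x → + 0 ℤ.≤ x → + q i ℤ.≤ x ℤ.+ + 1 ℤ.* + q i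
  q≤digit+q i x x≥0 = subst (λ z → + q i ℤ.≤ x ℤ.+ z) (sym (ℤP.*-identityˡ (+ q i)))
    (ℤP.≤-trans (ℤP.≤-reflexive (sym (ℤP.+-identityˡ (+ q i)))) (ℤP.+-monoˡ-≤ (+ q i) x≥0))

  first-difference : ∀ {A B} → ProperDigits q A → ProperDigits q B →
    ∀ k → (∀ j → 1 ≤ j → j ≤ k → A j ≡ B j) → B (suc k) ℤ.< A (suc k) →
    ¬ ConvergesTo (λ n → partialSum q A n ℚ.- partialSum q B n) 0ℚ
  first-difference {A} {B} (A-digits , _) (B-digits , B-slack) k agree B<A
    with B-slack (suc (suc k))
  ... | zero , () , _
  ... | suc m , s≤s k<m , _ , room =
    bounded-below⇒¬→0 diff (recipℕ (P (suc m))) (suc m) (recip-pos _ (P≥1 (suc m)))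
      (separated k agree B<A m k<m slack)
    where
    gap : ∀ i → 1 ≤ i → + 1 ℤ.+ B i ℤ.≤ A i ℤ.+ + 1 ℤ.* + q i
    gap i i≥1 = ℤP.≤-trans (ℤP.≤-reflexive (ℤP.+-comm (+ 1) (B i)))
      (ℤP.≤-trans (proj₂ (B-digits i i≥1)) (q≤digit+q i (A i) (proj₁ (A-digits i i≥1))))
    open TailEstimate q q≥1 A B gap
    slack : + 2 ℤ.+ B (suc m) ℤ.≤ A (suc m) ℤ.+ + 1 ℤ.* + q (suc m)
    slack = ℤP.≤-trans (ℤP.≤-reflexive (ℤP.+-comm (+ 2) (B (suc m))))
      (ℤP.≤-trans room (q≤digit+q (suc m) (A (suc m)) (proj₁ (A-digits (suc m) (s≤s z≤n)))))

  agree-upto : ∀ {A B} → ProperDigits q A → ProperDigits q B →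
    ConvergesTo (λ n → partialSum q A n ℚ.- partialSum q B n) 0ℚ →
    ∀ n j → 1 ≤ j → j ≤ n → A j ≡ B j
  agree-upto A-proper B-proper same zero    zero    () _
  agree-upto A-proper B-proper same zero    (suc j) _  ()
  agree-upto {A} {B} A-proper B-proper same (suc n) j j≥1 j≤n+1
    with ℕP.m≤n⇒m<n∨m≡n j≤n+1
  ... | inj₁ j≤n = agree-upto A-proper B-proper same n j j≥1 (ℕP.≤-pred j≤n)
  ... | inj₂ refl with ℤP.<-cmp (A (suc n)) (B (suc n))
  ...   | tri≈ _ A≡B _ = A≡B
  ...   | tri> _ _ B<A = ⊥-elim (first-difference A-proper B-proper n prefix B<A same)
    where
    prefix : ∀ i → 1 ≤ i → i ≤ n → A i ≡ B i
    prefix = agree-upto A-proper B-proper same n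
  ...   | tri< A<B _ _ = ⊥-elim (first-difference B-proper A-proper n prefix A<B
                                   (converges0-swap (partialSum q A) (partialSum q B) same))
    where
    prefix : ∀ i → 1 ≤ i → i ≤ n → B i ≡ A i
    prefix i i≥1 i≤n = sym (agree-upto A-proper B-proper same n i i≥1 i≤n)

  cantor-unique : ∀ {A B} → ProperDigits q A → ProperDigits q B →
    ConvergesTo (λ n → partialSum q A n ℚ.- partialSum q B n) 0ℚ → ∀ i → 1 ≤ i → A i ≡ B i
  cantor-unique A-proper B-proper same i i≥1 = agree-upto A-proper B-proper same i i i≥1 ℕP.≤-refl

-- v − 1 ≤ x implies v ≤ x + 1 (truncated subtraction); converts the defining
-- inequalities ν_{i+1} − 1 ≤ L_i of l into bounds on ν.
∸1≤⇒≤suc : ∀ v x → v ℕ.∸ 1 ≤ x → v ≤ suc x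
∸1≤⇒≤suc zero    x _ = z≤n
∸1≤⇒≤suc (suc v) x h = s≤s h

-- The block structure of S_Q: block a consists of the l_a runs b = 1..l_a of
-- length a, occupying positions L_{a−1} + 1, …, L_a.
module Indexing (q : ℕ → ℕ) (ν l : ℕ → ℕ) (isNu : IsNu q ν) (isL : IsL ν l) where

  l≥1 : ∀ a → 1 ≤ a → 1 ≤ l a
  l≥1 1               _ = subst (1 ≤_) (sym (proj₁ isL)) (ℕP.m≤n⊔m (ν 2 ℕ.∸ 1) 1)
  l≥1 (suc (suc a))   _ = proj₁ (proj₂ isL (suc (suc a)) (s≤s (s≤s z≤n)))

  i≤L : ∀ i → i ≤ Lsum l i
  i≤L zero    = z≤n
  i≤L (suc i) = subst (_≤ Lsum l (suc i)) (ℕP.+-comm i 1)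
    (ℕP.+-mono-≤ (i≤L i) (ℕP.*-mono-≤ {1} {suc i} (s≤s z≤n) (l≥1 (suc i) (s≤s z≤n))))

  ν≤block-start : ∀ a → 2 ≤ a → ν a ≤ suc (Lsum l (a ℕ.∸ 1))
  ν≤block-start (suc zero) (s≤s ())
  ν≤block-start (suc (suc zero)) _ = ∸1≤⇒≤suc _ _
    (subst (ν 2 ℕ.∸ 1 ≤_) (trans (sym (proj₁ isL)) (sym (ℕP.+-identityʳ (l 1))))
           (ℕP.m≤m⊔n (ν 2 ℕ.∸ 1) 1))
  ν≤block-start (suc (suc (suc a))) _ =
    ∸1≤⇒≤suc _ _ (proj₁ (proj₂ (proj₂ isL (suc (suc a)) (s≤s (s≤s z≤n)))))

  q-large : ∀ a b c → InS l a b c → 2 ≤ a → 2 ℕ.* (a ℕ.* a) ≤ q (φ l a b c)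
  q-large a b c (a≥1 , _ , _ , c≥1 , _) a≥2 = proj₁ (proj₂ (isNu a a≥1)) (φ l a b c)
    (ℕP.≤-trans (ν≤block-start a a≥2)
      (subst (_≤ φ l a b c) (ℕP.+-comm (Lsum l (a ℕ.∸ 1)) 1)
        (ℕP.+-mono-≤ (ℕP.m≤m+n (Lsum l (a ℕ.∸ 1)) ((b ℕ.∸ 1) ℕ.* a)) c≥1)))

  block-of : ∀ K n → 1 ≤ n → n ≤ Lsum l K → ∃[ a ] (1 ≤ a × Lsum l (a ℕ.∸ 1) < n × n ≤ Lsum l a)
  block-of zero    zero    () _
  block-of zero    (suc n) _  ()
  block-of (suc K) n n≥1 n≤L with n ≤? Lsum l K
  ... | yes n≤L' = block-of K n n≥1 n≤L'
  ... | no  n≰L' = suc K , s≤s z≤n , ℕP.≰⇒> n≰L' , n≤L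

  -- φ_Q is onto the positive integers: position n lies in block a, at
  -- offset r = n − L_{a−1} − 1 = (b−1)·a + (c−1).
  φ-onto : ∀ n → 1 ≤ n → ∃[ a ] ∃[ b ] ∃[ c ] (InS l a b c × φ l a b c ≡ n)
  φ-onto n n≥1 with block-of n n n≥1 (i≤L n)
  ... | zero , () , _
  ... | suc a' , _ , L<n , n≤L =
      a , suc (r / a) , suc (r % a) ,
      (s≤s z≤n , s≤s z≤n , m<n*o⇒m/o<n r<l·a , s≤s z≤n , m%n<n r a) , φ≡n
    where
    a = suc a'
    L = Lsum l a'
    r = n ℕ.∸ suc L
    n≡ : suc L ℕ.+ r ≡ n
    n≡ = ℕP.m+[n∸m]≡n L<n
    r<l·a : r < l a ℕ.* a
    r<l·a = subst (r <_) (ℕP.*-comm a (l a)) (ℕP.+-cancelˡ-≤ L _ _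
      (subst (_≤ L ℕ.+ a ℕ.* l a) (trans (sym n≡) (sym (ℕP.+-suc L r))) n≤L))
    φ≡n : L ℕ.+ (r / a) ℕ.* a ℕ.+ suc (r % a) ≡ n
    φ≡n = trans (ℕSolver.solve 3 (λ L x y → L :+ x :+ (con 1 :+ y) := con 1 :+ L :+ (y :+ x))
                   refl L ((r / a) ℕ.* a) (r % a))
                (trans (cong (suc L ℕ.+_) (sym (m≡m%n+[m/n]*n r a))) n≡)
      where open ℕSolver

-- A digit F at a position with base Q ≥ 2a² whose ratio F/Q lies in the
-- window [(c−1)/a − 1/(2a²), (c−1)/a + 1/(2a²)], where 2 ≤ c ≤ a, satisfies
-- 2 ≤ F ≤ Q − 1: the window lies strictly between 1/Q and 1.
module SpecialDigitBounds (a c Q : ℕ) (F : ℤ) (c≥2 : 2 ≤ c) (c≤a : c ≤ a)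
  (Q-large : 2 ℕ.* (a ℕ.* a) ≤ Q) where

  a≥2 : 2 ≤ a
  a≥2 = ℕP.≤-trans c≥2 c≤a

  a≥1 : 1 ≤ a
  a≥1 = ℕP.≤-trans (s≤s z≤n) a≥2

  2a² : ℕ
  2a² = 2 ℕ.* (a ℕ.* a)

  2a²≥1 : 1 ≤ 2a²
  2a²≥1 = ℕP.*-mono-≤ {1} {2} (s≤s z≤n) (ℕP.*-mono-≤ a≥1 a≥1)

  Q≥1 : 1 ≤ Q
  Q≥1 = ℕP.≤-trans 2a²≥1 Q-large

  rad mid ratio : ℚ
  rad   = recipℕ 2a²
  mid   = ι (+ (c ℕ.∸ 1)) ℚ.* recipℕ a
  ratio = ι F ℚ.* recipℕ Q

  recip-a·2a² : recipℕ a ℚ.* ι (+ 2a²) ≡ ι (+ (2 ℕ.* a))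
  recip-a·2a² = begin
    recipℕ a ℚ.* ι (+ 2a²)                          ≡⟨ cong (λ z → recipℕ a ℚ.* ι (+ z)) (ℕP.*-comm 2 (a ℕ.* a)) ⟩
    recipℕ a ℚ.* ι (+ (a ℕ.* a ℕ.* 2))              ≡⟨ cong (λ z → recipℕ a ℚ.* ι (+ z)) (ℕP.*-assoc a a 2) ⟩
    recipℕ a ℚ.* ι (+ (a ℕ.* (a ℕ.* 2)))            ≡⟨ cong (λ z → recipℕ a ℚ.* ι z) (ℤP.pos-* a (a ℕ.* 2)) ⟩
    recipℕ a ℚ.* ι (+ a ℤ.* + (a ℕ.* 2))            ≡⟨ cong (recipℕ a ℚ.*_) (ι-* (+ a) (+ (a ℕ.* 2))) ⟩
    recipℕ a ℚ.* (ι (+ a) ℚ.* ι (+ (a ℕ.* 2)))      ≡⟨ sym (ℚP.*-assoc (recipℕ a) _ _) ⟩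
    (recipℕ a ℚ.* ι (+ a)) ℚ.* ι (+ (a ℕ.* 2))      ≡⟨ cong (ℚ._* ι (+ (a ℕ.* 2))) (recip-inverse a a≥1) ⟩
    1ℚ ℚ.* ι (+ (a ℕ.* 2))                          ≡⟨ ℚP.*-identityˡ _ ⟩
    ι (+ (a ℕ.* 2))                                 ≡⟨ cong (λ z → ι (+ z)) (ℕP.*-comm a 2) ⟩
    ι (+ (2 ℕ.* a)) ∎
    where open ≡-Reasoning

  recip-a≤k·rad⇒2a≤k : ∀ k → recipℕ a ℚ.≤ ι (+ k) ℚ.* rad → 2 ℕ.* a ≤ k
  recip-a≤k·rad⇒2a≤k k h = ℤP.drop‿+≤+ (ι-cancel (begin
    ι (+ (2 ℕ.* a))                    ≡⟨ sym recip-a·2a² ⟩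
    recipℕ a ℚ.* ι (+ 2a²)             ≤⟨ *ι-mono 2a² h ⟩
    (ι (+ k) ℚ.* rad) ℚ.* ι (+ 2a²)    ≡⟨ ℚP.*-assoc (ι (+ k)) rad _ ⟩
    ι (+ k) ℚ.* (rad ℚ.* ι (+ 2a²))    ≡⟨ cong (ι (+ k) ℚ.*_) (recip-inverse 2a² 2a²≥1) ⟩
    ι (+ k) ℚ.* 1ℚ                     ≡⟨ ℚP.*-identityʳ _ ⟩
    ι (+ k) ∎))
    where open ℚP.≤-Reasoning

  2<2a : 2 < 2 ℕ.* a
  2<2a = ℕP.≤-trans (s≤s (s≤s (s≤s z≤n))) (ℕP.*-monoʳ-≤ 2 a≥2)

  -- The window lies above 1/Q, so F ≥ 2.
  lower : mid ℚ.- rad ℚ.≤ ratio → + 2 ℤ.≤ F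
  lower in-window with F ℤP.≤? + 1
  ... | no  F≰1 = ℤP.i<j⇒suc[i]≤j (ℤP.≰⇒> F≰1)
  ... | yes F≤1 = ⊥-elim (ℕP.<⇒≱ 2<2a (recip-a≤k·rad⇒2a≤k 2 recip-a≤2rad))
    where
    open ℚP.≤-Reasoning
    recip-a-rad≤rad : recipℕ a ℚ.- rad ℚ.≤ rad
    recip-a-rad≤rad = begin
      recipℕ a ℚ.- rad                ≡⟨ cong (ℚ._- rad) (sym (ℚP.*-identityˡ (recipℕ a))) ⟩
      ι (+ 1) ℚ.* recipℕ a ℚ.- rad    ≤⟨ ℚP.+-monoˡ-≤ (ℚ.- rad) (*recip-mono a (ι-mono (ℤ.+≤+ (ℕP.∸-monoˡ-≤ 1 c≥2)))) ⟩
      mid ℚ.- rad                     ≤⟨ in-window ⟩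
      ratio                           ≤⟨ *recip-mono Q (ι-mono F≤1) ⟩
      ι (+ 1) ℚ.* recipℕ Q            ≡⟨ ℚP.*-identityˡ (recipℕ Q) ⟩
      recipℕ Q                        ≤⟨ recip-antitone 2a² Q 2a²≥1 Q-large ⟩
      rad ∎
    recip-a≤2rad : recipℕ a ℚ.≤ ι (+ 2) ℚ.* rad
    recip-a≤2rad = subst₂ ℚ._≤_ (sub-add (recipℕ a) rad) (double rad) (ℚP.+-monoˡ-≤ rad recip-a-rad≤rad)
      where
      open ℚSolver
      sub-add : ∀ x r → (x ℚ.- r) ℚ.+ r ≡ x
      sub-add = solve 2 (λ x r → (x :- r) :+ r := x) refl
      double : ∀ r → r ℚ.+ r ≡ ι (+ 2) ℚ.* r
      double = solve 1 (λ r → r :+ r := (con 1ℚ :+ con 1ℚ) :* r) refl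

  -- The window lies below 1, so F ≤ Q − 1.
  upper : ratio ℚ.≤ mid ℚ.+ rad → F ℤ.+ + 1 ℤ.≤ + Q
  upper in-window with + Q ℤP.≤? F
  ... | no  Q≰F = subst (ℤ._≤ + Q) (ℤP.+-comm (+ 1) F) (ℤP.i<j⇒suc[i]≤j (ℤP.≰⇒> Q≰F))
  ... | yes Q≤F = ⊥-elim (ℕP.<⇒≱ (ℕP.≤-trans (s≤s (s≤s z≤n)) 2<2a) (recip-a≤k·rad⇒2a≤k 1 recip-a≤rad))
    where
    open ℚP.≤-Reasoning
    -- (a−1)/a, the largest possible centre of the window
    top : ℚ
    top = ι (+ (a ℕ.∸ 1)) ℚ.* recipℕ a
    add-sub : ∀ t x → (t ℚ.+ x) ℚ.- t ≡ x
    add-sub = solve 2 (λ t x → (t :+ x) :- t := x) refl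
      where open ℚSolver
    top+recip-a : top ℚ.+ recipℕ a ≡ 1ℚ
    top+recip-a = begin-equality
      top ℚ.+ recipℕ a                              ≡⟨ cong (top ℚ.+_) (sym (ℚP.*-identityˡ (recipℕ a))) ⟩
      top ℚ.+ ι (+ 1) ℚ.* recipℕ a                  ≡⟨ sym (ℚP.*-distribʳ-+ (recipℕ a) (ι (+ (a ℕ.∸ 1))) (ι (+ 1))) ⟩
      (ι (+ (a ℕ.∸ 1)) ℚ.+ ι (+ 1)) ℚ.* recipℕ a    ≡⟨ cong (ℚ._* recipℕ a) (sym (ι-+ (+ (a ℕ.∸ 1)) (+ 1))) ⟩
      ι (+ (a ℕ.∸ 1 ℕ.+ 1)) ℚ.* recipℕ a            ≡⟨ cong (λ z → ι (+ z) ℚ.* recipℕ a) (ℕP.m∸n+n≡m a≥1) ⟩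
      ι (+ a) ℚ.* recipℕ a                          ≡⟨ ℚP.*-comm (ι (+ a)) (recipℕ a) ⟩
      recipℕ a ℚ.* ι (+ a)                          ≡⟨ recip-inverse a a≥1 ⟩
      1ℚ ∎
    1≤top+rad : 1ℚ ℚ.≤ top ℚ.+ rad
    1≤top+rad = begin
      1ℚ                     ≡⟨ sym (trans (ℚP.*-comm (ι (+ Q)) (recipℕ Q)) (recip-inverse Q Q≥1)) ⟩
      ι (+ Q) ℚ.* recipℕ Q   ≤⟨ *recip-mono Q (ι-mono Q≤F) ⟩
      ratio                  ≤⟨ in-window ⟩
      mid ℚ.+ rad            ≤⟨ ℚP.+-monoˡ-≤ rad (*recip-mono a (ι-mono (ℤ.+≤+ (ℕP.∸-monoˡ-≤ 1 c≤a)))) ⟩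
      top ℚ.+ rad ∎
    recip-a≤rad : recipℕ a ℚ.≤ ι (+ 1) ℚ.* rad
    recip-a≤rad = begin
      recipℕ a                   ≡⟨ sym (add-sub top (recipℕ a)) ⟩
      (top ℚ.+ recipℕ a) ℚ.- top ≡⟨ cong (ℚ._- top) top+recip-a ⟩
      1ℚ ℚ.- top                 ≤⟨ ℚP.+-monoˡ-≤ (ℚ.- top) 1≤top+rad ⟩
      (top ℚ.+ rad) ℚ.- top      ≡⟨ add-sub top rad ⟩
      rad                        ≡⟨ sym (ℚP.*-identityˡ rad) ⟩
      ι (+ 1) ℚ.* rad ∎

module SpecialExpansion (q : ℕ → ℕ) (basic : IsBasic q) (ν l : ℕ → ℕ)
  (isNu : IsNu q ν) (isL : IsL ν l) (F : ℕ → ℕ → ℕ → ℤ) (special : IsSpecial q l F)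
  (E : ℕ → ℤ) (E-φ : ∀ a b c → InS l a b c → E (φ l a b c) ≡ F a b c) where

  open Indexing q ν l isNu isL

  large-digit : ∀ a b c → InS l a b c → 2 ≤ c →
    (+ 2 ℤ.≤ F a b c) × (F a b c ℤ.+ + 1 ℤ.≤ + q (φ l a b c))
  large-digit a b c ins@(_ , _ , _ , _ , c≤a) c≥2 = lower (proj₁ window) , upper (proj₂ window)
    where
    open SpecialDigitBounds a c (q (φ l a b c)) (F a b c) c≥2 c≤a
      (q-large a b c ins (ℕP.≤-trans c≥2 c≤a))
    window : (mid ℚ.- rad ℚ.≤ ratio) × (ratio ℚ.≤ mid ℚ.+ rad)
    window = proj₂ special a b c ins c≥2

  -- Since φ_Q is onto, every digit is of one of the two kinds.
  digit-shape : ∀ n → 1 ≤ n → (E n ≡ + 0) ⊎ ((+ 2 ℤ.≤ E n) × (E n ℤ.+ + 1 ℤ.≤ + q n))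
  digit-shape n n≥1 with φ-onto n n≥1
  ... | a , b , zero , (_ , _ , _ , () , _) , _
  ... | a , b , suc zero , ins , refl = inj₁ (trans (E-φ a b 1 ins) (proj₁ special a b ins))
  ... | a , b , suc (suc c) , ins , refl rewrite E-φ a b (suc (suc c)) ins =
    inj₂ (large-digit a b (suc (suc c)) ins (s≤s (s≤s z≤n)))

  E≢1 : ∀ n → 1 ≤ n → E n ≢ + 1
  E≢1 n n≥1 E≡1 with digit-shape n n≥1
  ... | inj₁ E≡0        = 0≢1 (trans (sym E≡0) E≡1)
    where 0≢1 : + 0 ≢ + 1
          0≢1 ()
  ... | inj₂ (E≥2 , _) = ℤP.<⇒≱ (ℤ.+<+ (s≤s (s≤s z≤n))) (subst (+ 2 ℤ.≤_) E≡1 E≥2)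

  -- E is a proper digit sequence; its zeros at the positions φ(M+1, 1, 1) ≥ M
  -- are the infinitely many non-maximal digits.
  E-proper : ProperDigits q E
  E-proper = digit-range , infinitely-many-zeros
    where
    digit-range : ∀ n → 1 ≤ n → (+ 0 ℤ.≤ E n) × (E n ℤ.+ + 1 ℤ.≤ + q n)
    digit-range n n≥1 with digit-shape n n≥1
    ... | inj₁ E≡0 rewrite E≡0 =
      ℤP.≤-refl , ℤ.+≤+ (ℕP.≤-trans (s≤s z≤n) (basic n n≥1))
    ... | inj₂ (E≥2 , E<q) = ℤP.≤-trans (ℤ.+≤+ z≤n) E≥2 , E<q
    infinitely-many-zeros : ∀ M → ∃[ n ] (M ≤ n × 1 ≤ n × E n ℤ.+ + 2 ℤ.≤ + q n)
    infinitely-many-zeros M = φ l (suc M) 1 1 , M≤n , ℕP.m≤n+m 1 _ ,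
      subst (λ z → z ℤ.+ + 2 ℤ.≤ + q (φ l (suc M) 1 1)) (sym E≡0) (ℤ.+≤+ (basic _ (ℕP.m≤n+m 1 _)))
      where
      ins : InS l (suc M) 1 1
      ins = s≤s z≤n , s≤s z≤n , l≥1 (suc M) (s≤s z≤n) , s≤s z≤n , s≤s z≤n
      M≤n : M ≤ φ l (suc M) 1 1
      M≤n = ℕP.≤-trans (i≤L M) (ℕP.≤-trans (ℕP.m≤m+n (Lsum l M) 0) (ℕP.m≤m+n _ 1))
      E≡0 : E (φ l (suc M) 1 1) ≡ + 0
      E≡0 = trans (E-φ (suc M) 1 1 ins) (proj₁ special (suc M) 1 ins)

cantor-digits-proper : ∀ q D → IsCantorDigits q D → ProperDigits q (+_ ∘ D)
cantor-digits-proper q D (D<q , not-max) = digit-range , slack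
  where
  digit-range : ∀ n → 1 ≤ n → (+ 0 ℤ.≤ + D n) × (+ D n ℤ.+ + 1 ℤ.≤ + q n)
  digit-range n n≥1 = ℤ.+≤+ z≤n , ℤ.+≤+ (subst (_≤ q n) (ℕP.+-comm 1 (D n)) (D<q n n≥1))
  slack : ∀ M → ∃[ n ] (M ≤ n × 1 ≤ n × + D n ℤ.+ + 2 ℤ.≤ + q n)
  slack M with not-max M
  ... | n , M≤n , n≥1 , D≢q-1 = n , M≤n , n≥1 , ℤ.+≤+ (subst (_≤ q n) (ℕP.+-comm 2 (D n))
          (ℕP.≤∧≢⇒< (D<q n n≥1) (λ D+1≡q → D≢q-1 (cong (ℕ._∸ 1) D+1≡q))))

count-absent : ∀ D d → (∀ j → 1 ≤ j → D j ≢ d) → ∀ n → countDigit D d n ≡ 0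
count-absent D d absent zero = refl
count-absent D d absent (suc n) with D (suc n) ℕ.≟ d
... | yes D≡d = ⊥-elim (absent (suc n) (s≤s z≤n) D≡d)
... | no  _   = trans (ℕP.+-identityʳ _) (count-absent D d absent n)

-- 0/r = 0 (including Defs' convention 0/0 = 0).
divℚ-zeroˡ : ∀ r → divℚ 0ℚ r ≡ 0ℚ
divℚ-zeroˡ r with r ℚP.≟ 0ℚ
... | yes _   = refl
... | no  r≢0 = ℚP.*-zeroˡ (ℚ.1/_ r {{ℚ.≢-nonZero r≢0}})

absent-digit⇒¬simply-normal : ∀ q D d → (∀ j → 1 ≤ j → D j ≢ d) → ¬ SimplyNormal q D
absent-digit⇒¬simply-normal q D d absent normal with normal d 1ℚ (ℚP.positive⁻¹ 1ℚ)
... | N , close = ℚP.<-irrefl refl (subst (λ z → ℚ.∣ z ℚ.- 1ℚ ∣ ℚ.< 1ℚ) ratio≡0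
                                      (close (suc N) (ℕP.n≤1+n N) (s≤s z≤n)))
  where
  ratio≡0 : divℚ (ι (+ countDigit D d (suc N))) (Q1 q (suc N)) ≡ 0ℚ
  ratio≡0 = trans (cong (λ k → divℚ (ι (+ k)) (Q1 q (suc N))) (count-absent D d absent (suc N)))
                  (divℚ-zeroˡ (Q1 q (suc N)))

mainTheorem2 : (q : ℕ → ℕ) → IsBasic q → InfiniteInLimit q →
    (ν l : ℕ → ℕ) → IsNu q ν → IsL ν l →
    (F : ℕ → ℕ → ℕ → ℤ) → IsSpecial q l F →
    (EF : ℕ → ℤ) → (∀ a b c → InS l a b c → EF (φ l a b c) ≡ F a b c) →
    (D : ℕ → ℕ) → IsCantorDigits q D → SameValue q D EF →
    ¬ SimplyNormal q D
mainTheorem2 q basic _ ν l isNu isL F special EF EF-φ D cantor same =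
  absent-digit⇒¬simply-normal q D 1 D≢1
  where
  open SpecialExpansion q basic ν l isNu isL F special EF EF-φ
  -- x_F has a unique proper expansion, so its digits are those of E_F.
  D≡EF : ∀ n → 1 ≤ n → + D n ≡ EF n
  D≡EF = Uniqueness.cantor-unique q basic (cantor-digits-proper q D cantor) E-proper same
  D≢1 : ∀ n → 1 ≤ n → D n ≢ 1
  D≢1 n n≥1 D≡1 = E≢1 n n≥1 (trans (sym (D≡EF n n≥1)) (cong +_ D≡1))
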